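{- There exists a collection of languages that is generatable in the limit with noise level $i$ for every $i\in\mathbb N$, but is not noisily generatable in the limit.
   Context: A language is an infinite subset of a countably infinite universe $U$; a collection is a set of languages. A generator algorithm is an arbitrary function $G$ from finite sequences of elements of $U$ to $U$, with output $z_t=G(x_0,\dots,x_t)$, and $S_t=\{x_0,\dots,x_t\}$. A noisy enumeration of $K$ is an infinite sequence $x_0,x_1,\dots$ of pairwise distinct elements of $U$ with $K\subseteq\bigcup_j\{x_j\}$ and $|\bigcup_j\{x_j\}\setminus K|<\infty$; it has noise level $i$ if moreover $|\bigcup_j\{x_j\}\setminus K|\le i$. $G$ generates in the limit with noise level $i$ for $\mathcal C$ if for every $K\in\mathcal C$ and every noisy enumeration of $K$ with noise level at most $i$ there is $t^\star$ with $z_t\in K\setminus S_t$ for all $t\ge t^\star$ (the algorithm may depend on $i$). $G$ noisily generates in the limit for $\mathcal C$ if for every $K\in\mathcal C$ and every noisy enumeration of $K$ (of any finite noise level, unknown to $G$) there is $t^\star$ with $z_t\in K\setminus S_t$ for all $t\ge t^\star$. -}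

module Defs where

open import Data.Nat using (ℕ; suc; _≤_)
open import Data.List using (List; []; _∷_; length; _∷ʳ_)
open import Data.List.Membership.Propositional using (_∈_)
open import Data.Product using (Σ; ∃; ∃-syntax; _×_; _,_)
open import Relation.Binary.PropositionalEquality using (_≡_)
open import Relation.Nullary using (¬_)
open import Function.Definitions using (Injective)

U : Set
U = ℕ

Subset : Set₁
Subset = U → Set

Infinite : Subset → Set
Infinite L = ∀ n → ∃[ m ] (n ≤ m × L m)

Collection : Set₂
Collection = Subset → Set₁

IsCollectionOfLanguages : Collection → Set₁
IsCollectionOfLanguages C = ∀ L → C L → Infinite L

Generator : Set
Generator = List U → U

prefix : (ℕ → U) → ℕ → List U
prefix x 0 = x 0 ∷ []
prefix x (suc t) = prefix x t ∷ʳ x (suc t)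

out : Generator → (ℕ → U) → ℕ → U
out G x t = G (prefix x t)

S : (ℕ → U) → ℕ → U → Set
S x t z = z ∈ prefix x t

InRange : (ℕ → U) → U → Set
InRange x z = ∃[ j ] (x j ≡ z)

-- |⋃_j {x_j} ∖ K| ≤ i : the noise is contained in a list of length ≤ i.
NoiseAtMost : ℕ → Subset → (ℕ → U) → Set
NoiseAtMost i K x = ∃[ N ] (length N ≤ i × (∀ j → ¬ K (x j) → x j ∈ N))

NoisyEnumeration : Subset → (ℕ → U) → Set
NoisyEnumeration K x =
  Injective _≡_ _≡_ x × (∀ z → K z → InRange x z) × ∃[ i ] NoiseAtMost i K x

NoisyEnumerationLevel : ℕ → Subset → (ℕ → U) → Set
NoisyEnumerationLevel i K x =
  Injective _≡_ _≡_ x × (∀ z → K z → InRange x z) × NoiseAtMost i K x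

EventuallyGenerates : Generator → Subset → (ℕ → U) → Set
EventuallyGenerates G K x =
  ∃[ t⋆ ] (∀ t → t⋆ ≤ t → K (out G x t) × ¬ S x t (out G x t))

GeneratesWithNoise : ℕ → Collection → Generator → Set₁
GeneratesWithNoise i C G =
  ∀ K → C K → ∀ x → NoisyEnumerationLevel i K x → EventuallyGenerates G K x

NoisilyGenerates : Collection → Generator → Set₁
NoisilyGenerates C G =
  ∀ K → C K → ∀ x → NoisyEnumeration K x → EventuallyGenerates G K x

-- Identify U with ℕ × ℕ and call the first coordinate the column. The
-- collection consists of the languages containing a whole column a and
-- nothing to the left of it. With noise at most i the anchor a is the leftmost
-- column of which more than i elements have been seen: eventually column a has
-- i + 1 of them, while every column to its left consists of noise only.
--
-- When the noise is unbounded, a generator G is diagonalised. At stage k we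
-- show G the part committed so far followed by column k + 1, a noisy
-- enumeration of that column, and wait for the time T at which G has settled
-- on fresh elements of it. We then commit everything shown up to T and the
-- marker (0 , k), and pass to column k + 2. The limit enumerates, without
-- noise, a language containing all of column 0 (the markers); at every time T
-- it looks to G exactly like stage k, so G outputs an element of column k + 1
-- that was not shown by time T, hence is never enumerated.
module Submission where

open import Defs
open import Data.Product using (Σ; ∃; ∃-syntax; _×_)
open import Relation.Nullary using (¬_)

open import Data.Empty using (⊥; ⊥-elim)
open import Data.List using (List; []; _∷_; [_]; _++_; _∷ʳ_; length; map; filter; applyUpTo)
open import Data.List.Extrema.Nat using (min; max; min≈v⁺; xs≤max)
open import Data.List.Membership.Propositional using (_∈_; _∉_; _─_)
open import Data.List.Membership.Propositional.Properties
  using (∈-applyUpTo⁺; ∈-applyUpTo⁻; ∈-map⁺; ∈-filter⁺; ∈-filter⁻; ∈-++⁺ˡ; ∈-++⁺ʳ; ∈-++⁻)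
open import Data.List.Properties using (applyUpTo-∷ʳ; length-applyUpTo; length-map; length-++; length-removeAt′; ++-assoc)
open import Data.List.Relation.Binary.Subset.Propositional using (_⊆_)
open import Data.List.Relation.Unary.All as All using (All; []; _∷_)
open import Data.List.Relation.Unary.All.Properties using (++⁺; applyUpTo⁺₁)
open import Data.List.Relation.Unary.AllPairs using ([]; _∷_)
open import Data.List.Relation.Unary.Any using (here; there; index)
open import Data.List.Relation.Unary.Unique.Propositional using (Unique)
import Data.List.Relation.Unary.Unique.Propositional.Properties as Unique
open import Data.Nat
open import Data.Nat.Properties
open import Data.Product using (_,_; proj₁; proj₂)
open import Data.Sum as Sum using (_⊎_; inj₁; inj₂)
open import Data.Vec using (Vec; []; _∷_)
open import Function using (_∘_)
open import Function.Definitions using (Injective)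
open import Relation.Binary.PropositionalEquality hiding ([_])

private
  variable
    A : Set
    x y : A
    xs ys : List A
    a b i j k k′ m n t : ℕ

-- Cantor pairing

triangle : ℕ → ℕ
triangle zero = zero
triangle (suc d) = suc d + triangle d

encode : ℕ × ℕ → ℕ
encode (a , m) = triangle (a + m) + a

-- walks each diagonal a + m = d from (0 , d) down to (d , 0)
next : ℕ × ℕ → ℕ × ℕ
next (a , zero) = 0 , suc a
next (a , suc m) = suc a , m

decode : ℕ → ℕ × ℕ
decode zero = 0 , 0
decode (suc z) = next (decode z)

decode-diagonal : ∀ d a → a ≤ d → decode (triangle d + a) ≡ (a , d ∸ a)
decode-diagonal zero zero _ = refl
decode-diagonal (suc d) zero _ = begin
  decode (suc d + triangle d + 0)   ≡⟨ cong decode (trans (+-identityʳ _) (cong suc (+-comm d (triangle d)))) ⟩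
  next (decode (triangle d + d))     ≡⟨ cong next (decode-diagonal d d ≤-refl) ⟩
  next (d , d ∸ d)                   ≡⟨ cong (λ r → next (d , r)) (n∸n≡0 d) ⟩
  (0 , suc d)                        ∎
  where open ≡-Reasoning
decode-diagonal d (suc a) a<d = begin
  decode (triangle d + suc a)        ≡⟨ cong decode (+-suc (triangle d) a) ⟩
  next (decode (triangle d + a))     ≡⟨ cong next (decode-diagonal d a (<⇒≤ a<d)) ⟩
  next (a , d ∸ a)                   ≡⟨ cong (λ r → next (a , r)) (+-∸-assoc 1 a<d) ⟩
  (suc a , d ∸ suc a)                ∎
  where open ≡-Reasoning

decode-encode : ∀ p → decode (encode p) ≡ p
decode-encode (a , m) =
  trans (decode-diagonal (a + m) a (m≤m+n a m)) (cong (a ,_) (m+n∸m≡n a m))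

encode-injective : Injective _≡_ _≡_ encode
encode-injective {p} {q} eq = trans (sym (decode-encode p)) (trans (cong decode eq) (decode-encode q))

n≤triangle : ∀ n → n ≤ triangle n
n≤triangle zero = z≤n
n≤triangle (suc n) = m≤m+n (suc n) (triangle n)

row≤encode : ∀ a m → m ≤ encode (a , m)
row≤encode a m = ≤-trans (m≤n+m m a) (≤-trans (n≤triangle (a + m)) (m≤m+n _ a))

col : U → ℕ
col z = proj₁ (decode z)

col-encode : ∀ a m → col (encode (a , m)) ≡ a
col-encode a m = cong proj₁ (decode-encode (a , m))

Column : ℕ → Subset
Column a z = ∃[ m ] z ≡ encode (a , m)

∈-─⁺ : (p : y ∈ ys) → x ∈ ys → x ≢ y → x ∈ ys ─ p
∈-─⁺ (here refl) (here refl) x≢y = ⊥-elim (x≢y refl)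
∈-─⁺ (here _) (there q) _ = q
∈-─⁺ (there p) (here refl) _ = here refl
∈-─⁺ (there p) (there q) x≢y = there (∈-─⁺ p q x≢y)

unique-⊆⇒length≤ : Unique xs → xs ⊆ ys → length xs ≤ length ys
unique-⊆⇒length≤ [] _ = z≤n
unique-⊆⇒length≤ {xs = x ∷ xs} {ys} (x≢xs ∷ xs-unique) xs⊆ys = begin
  suc (length xs)          ≤⟨ s≤s (unique-⊆⇒length≤ xs-unique xs⊆ys─x) ⟩
  suc (length (ys ─ x∈ys)) ≡⟨ length-removeAt′ ys (index x∈ys) ⟨
  length ys                ∎
  where
  open ≤-Reasoning
  x∈ys : x ∈ ys
  x∈ys = xs⊆ys (here refl)
  xs⊆ys─x : xs ⊆ ys ─ x∈ys
  xs⊆ys─x z∈xs = ∈-─⁺ x∈ys (xs⊆ys (there z∈xs)) (All.lookup x≢xs z∈xs ∘ sym)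

prefix≡applyUpTo : ∀ (x : ℕ → U) t → prefix x t ≡ applyUpTo x (suc t)
prefix≡applyUpTo x zero = refl
prefix≡applyUpTo x (suc t) =
  trans (cong (_∷ʳ x (suc t)) (prefix≡applyUpTo x t)) (applyUpTo-∷ʳ x (suc t))

∈-prefix⁺ : ∀ (x : ℕ → U) → j ≤ t → x j ∈ prefix x t
∈-prefix⁺ {t = t} x j≤t rewrite prefix≡applyUpTo x t = ∈-applyUpTo⁺ x (s≤s j≤t)

∈-prefix⁻ : ∀ (x : ℕ → U) {z} → z ∈ prefix x t → ∃[ j ] z ≡ x j
∈-prefix⁻ {t = t} x z∈ rewrite prefix≡applyUpTo x t with j , _ , eq ← ∈-applyUpTo⁻ x z∈ = j , eq

prefix-unique : ∀ {x : ℕ → U} → Injective _≡_ _≡_ x → ∀ t → Unique (prefix x t)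
prefix-unique {x} x-inj t rewrite prefix≡applyUpTo x t =
  Unique.applyUpTo⁺₁ x (suc t) (λ i<j _ → <⇒≢ i<j ∘ x-inj)

prefix-cong : ∀ {x y : ℕ → U} → (∀ {j} → j ≤ t → x j ≡ y j) → prefix x t ≡ prefix y t
prefix-cong {zero} x≈y = cong [_] (x≈y z≤n)
prefix-cong {suc t} x≈y = cong₂ _∷ʳ_ (prefix-cong (x≈y ∘ m≤n⇒m≤1+n)) (x≈y ≤-refl)

eventually-⊆-prefix : ∀ (x : ℕ → U) ys → (∀ {y} → y ∈ ys → InRange x y) →
                      ∃[ t⋆ ] (∀ {t} → t⋆ ≤ t → ys ⊆ prefix x t)
eventually-⊆-prefix x [] _ = 0 , λ _ ()
eventually-⊆-prefix x (y ∷ ys) ys⊆x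
  with j , refl ← ys⊆x (here refl)
     | t⋆ , ⊆prefix ← eventually-⊆-prefix x ys (ys⊆x ∘ there) =
  j ⊔ t⋆ , λ where
    le (here refl) → ∈-prefix⁺ x (≤-trans (m≤m⊔n j t⋆) le)
    le (there y∈ys) → ⊆prefix (≤-trans (m≤n⊔m j t⋆) le) y∈ys

record Anchored (K : Subset) : Set₁ where
  field
    anchor : ℕ
    column⊆ : ∀ m → K (encode (anchor , m))
    ⊆right : ∀ {z} → K z → anchor ≤ col z

anchored-infinite : IsCollectionOfLanguages Anchored
anchored-infinite K K-anchored n = encode (anchor , n) , row≤encode anchor n , column⊆ n
  where open Anchored K-anchored

Column-anchored : ∀ a → Anchored (Column a)
Column-anchored a = record
  { anchor = a
  ; column⊆ = λ m → m , refl
  ; ⊆right = λ { (m , refl) → ≤-reflexive (sym (col-encode a m)) }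
  }

-- Generation with noise level i

count : ℕ → List U → ℕ
count a l = length (filter (λ z → col z ≟ a) l)

heavyColumns : ℕ → List U → List ℕ
heavyColumns i l = filter (λ b → i <? count b l) (map col l)

-- the default max 0 (map col l) is at least every heavy column, so it only shows when there is none
leastHeavyColumn : ℕ → List U → ℕ
leastHeavyColumn i l = min (max 0 (map col l)) (heavyColumns i l)

leastHeavyColumn≡ : ∀ {l} → a ∈ map col l → i < count a l → (∀ {b} → b < a → count b l ≤ i) →
                    leastHeavyColumn i l ≡ a
leastHeavyColumn≡ {a} {i} {l} a∈cols a-heavy left-light =
  min≈v⁺ (∈-filter⁺ (λ b → i <? count b l) a∈cols a-heavy)
         (All.tabulate a≤heavy) (All.lookup (xs≤max 0 (map col l)) a∈cols)
  where
  a≤heavy : b ∈ heavyColumns i l → a ≤ b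
  a≤heavy b∈ = ≮⇒≥ λ b<a →
    <⇒≱ (proj₂ (∈-filter⁻ (λ b → i <? count b l) {xs = map col l} b∈)) (left-light b<a)

generator : ℕ → Generator
generator i l = encode (leastHeavyColumn i l , suc (max 0 l))

generator-fresh : ∀ i l → generator i l ∉ l
generator-fresh i l out∈l =
  1+n≰n (≤-trans (row≤encode (leastHeavyColumn i l) _) (All.lookup (xs≤max 0 l) out∈l))

generator-correct : ∀ i → GeneratesWithNoise i Anchored (generator i)
generator-correct i K K-anchored x (x-inj , K⊆x , N , |N|≤i , noise⊆N) =
  proj₁ seen , λ t t⋆≤t → output∈K {t} (proj₂ seen t⋆≤t) , generator-fresh i (prefix x t)
  where
  open Anchored K-anchored

  columnEntry : ℕ → U
  columnEntry m = encode (anchor , m)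

  columnStart : List U
  columnStart = applyUpTo columnEntry (suc i)

  columnStart⊆K : ∀ {y} → y ∈ columnStart → K y
  columnStart⊆K y∈ with m , _ , refl ← ∈-applyUpTo⁻ columnEntry y∈ = column⊆ m

  columnStart-unique : Unique columnStart
  columnStart-unique = Unique.applyUpTo⁺₁ columnEntry (suc i)
    (λ m<m′ _ → <⇒≢ m<m′ ∘ cong proj₂ ∘ encode-injective {anchor , _} {anchor , _})

  columnStart-column : ∀ {y} → y ∈ columnStart → col y ≡ anchor
  columnStart-column y∈ with m , _ , refl ← ∈-applyUpTo⁻ columnEntry y∈ = col-encode anchor m

  seen : ∃[ t⋆ ] (∀ {t} → t⋆ ≤ t → columnStart ⊆ prefix x t)
  seen = eventually-⊆-prefix x columnStart (λ y∈ → K⊆x _ (columnStart⊆K y∈))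

  module _ {t} (start⊆l : columnStart ⊆ prefix x t) where
    l = prefix x t

    anchor-heavy : i < count anchor l
    anchor-heavy = subst (_≤ count anchor l) (length-applyUpTo columnEntry (suc i))
      (unique-⊆⇒length≤ columnStart-unique
        (λ y∈ → ∈-filter⁺ (λ z → col z ≟ anchor) (start⊆l y∈) (columnStart-column y∈)))

    left-light : b < anchor → count b l ≤ i
    left-light {b} b<anchor = ≤-trans (unique-⊆⇒length≤
      (Unique.filter⁺ (λ z → col z ≟ b) (prefix-unique x-inj t)) column⊆N) |N|≤i
      where
      column⊆N : filter (λ z → col z ≟ b) l ⊆ N
      column⊆N z∈ with z∈l , refl ← ∈-filter⁻ (λ z → col z ≟ b) {xs = l} z∈
        with j , refl ← ∈-prefix⁻ {t = t} x z∈l =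
        noise⊆N j (λ K-xj → <⇒≱ b<anchor (⊆right K-xj))

    anchor∈l : anchor ∈ map col l
    anchor∈l = subst (_∈ map col l) (col-encode anchor 0) (∈-map⁺ col (start⊆l (here refl)))

    output∈K : K (out (generator i) x t)
    output∈K = subst (λ c → K (encode (c , _)))
      (sym (leastHeavyColumn≡ anchor∈l anchor-heavy left-light)) (column⊆ _)

infixr 5 _++ˢ_

_++ˢ_ : List A → (ℕ → A) → ℕ → A
([] ++ˢ f) j = f j
((x ∷ xs) ++ˢ f) zero = x
((x ∷ xs) ++ˢ f) (suc j) = (xs ++ˢ f) j

++ˢ-assoc : ∀ (xs ys : List A) f j → ((xs ++ ys) ++ˢ f) j ≡ (xs ++ˢ ys ++ˢ f) j
++ˢ-assoc [] ys f j = refl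
++ˢ-assoc (x ∷ xs) ys f zero = refl
++ˢ-assoc (x ∷ xs) ys f (suc j) = ++ˢ-assoc xs ys f j

++ˢ-length+ : ∀ (xs : List A) f m → (xs ++ˢ f) (length xs + m) ≡ f m
++ˢ-length+ [] f m = refl
++ˢ-length+ (x ∷ xs) f m = ++ˢ-length+ xs f m

++ˢ-∈ : ∀ (xs : List A) f {j} → j < length xs → (xs ++ˢ f) j ∈ xs
++ˢ-∈ (x ∷ xs) f {zero} _ = here refl
++ˢ-∈ (x ∷ xs) f {suc j} (s≤s j<) = there (++ˢ-∈ xs f j<)

++ˢ-∈⊎ : ∀ (xs : List A) f j → (xs ++ˢ f) j ∈ xs ⊎ ∃[ m ] (xs ++ˢ f) j ≡ f m
++ˢ-∈⊎ [] f j = inj₂ (j , refl)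
++ˢ-∈⊎ (x ∷ xs) f zero = inj₁ (here refl)
++ˢ-∈⊎ (x ∷ xs) f (suc j) = Sum.map₁ there (++ˢ-∈⊎ xs f j)

∈⇒++ˢ : ∀ (f : ℕ → A) → x ∈ xs → ∃[ j ] (j < length xs × (xs ++ˢ f) j ≡ x)
∈⇒++ˢ f (here refl) = 0 , s≤s z≤n , refl
∈⇒++ˢ f (there x∈) with j , j< , eq ← ∈⇒++ˢ f x∈ = suc j , s≤s j< , eq

++ˢ-agree : ∀ (xs : List A) {f g ℓ} → (∀ {m} → m < ℓ → f m ≡ g m) →
            ∀ {j} → j < length xs + ℓ → (xs ++ˢ f) j ≡ (xs ++ˢ g) j
++ˢ-agree [] f≈g j< = f≈g j<
++ˢ-agree (x ∷ xs) f≈g {zero} _ = refl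
++ˢ-agree (x ∷ xs) f≈g {suc j} (s≤s j<) = ++ˢ-agree xs f≈g j<

++ˢ-applyUpTo : ∀ (f : ℕ → A) {ℓ} ys g {m} → m < ℓ → ((applyUpTo f ℓ ++ ys) ++ˢ g) m ≡ f m
++ˢ-applyUpTo f {suc ℓ} ys g {zero} _ = refl
++ˢ-applyUpTo f {suc ℓ} ys g {suc m} (s≤s m<) = ++ˢ-applyUpTo (f ∘ suc) ys g m<

++ˢ-≢head : ∀ {f : ℕ → A} → All (x ≢_) xs → (∀ m → f m ∉ x ∷ xs) → ∀ j → (xs ++ˢ f) j ≢ x
++ˢ-≢head {xs = xs} {f} x≢xs f-fresh j eq with ++ˢ-∈⊎ xs f j
... | inj₁ ∈xs = All.lookup x≢xs ∈xs (sym eq)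
... | inj₂ (m , eq′) = f-fresh m (here (trans (sym eq′) eq))

++ˢ-injective : ∀ {f : ℕ → A} → Unique xs → Injective _≡_ _≡_ f → (∀ m → f m ∉ xs) →
                Injective _≡_ _≡_ (xs ++ˢ f)
++ˢ-injective {xs = []} _ f-inj _ = f-inj
++ˢ-injective {xs = x ∷ xs} _ _ _ {zero} {zero} _ = refl
++ˢ-injective {xs = x ∷ xs} (x≢xs ∷ _) _ f-fresh {zero} {suc j} eq = ⊥-elim (++ˢ-≢head x≢xs f-fresh j (sym eq))
++ˢ-injective {xs = x ∷ xs} (x≢xs ∷ _) _ f-fresh {suc j} {zero} eq = ⊥-elim (++ˢ-≢head x≢xs f-fresh j eq)
++ˢ-injective {xs = x ∷ xs} (_ ∷ xs-unique) f-inj f-fresh {suc j} {suc j′} eq =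
  cong suc (++ˢ-injective xs-unique f-inj (λ m → f-fresh m ∘ there) eq)

block : ℕ → ℕ → List (ℕ × ℕ)
block k ℓ = applyUpTo (suc k ,_) ℓ ++ [ 0 , k ]

-- the head of the vector is the length of the last block
layout : Vec ℕ n → List (ℕ × ℕ)
layout [] = []
layout {suc n} (ℓ ∷ ℓs) = layout ℓs ++ block n ℓ

data Settled (n : ℕ) : ℕ × ℕ → Set where
  marker : k < n → Settled n (0 , k)
  entry : ∀ {m} → k < n → Settled n (suc k , m)

Settled-suc : ∀ {p} → Settled n p → Settled (suc n) p
Settled-suc (marker k<n) = marker (m≤n⇒m≤1+n k<n)
Settled-suc (entry k<n) = entry (m≤n⇒m≤1+n k<n)

block-settled : ∀ ℓ → All (Settled (suc k)) (block k ℓ)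
block-settled ℓ = ++⁺ (applyUpTo⁺₁ _ ℓ (λ _ → entry ≤-refl)) (marker ≤-refl ∷ [])

layout-settled : (ℓs : Vec ℕ n) → All (Settled n) (layout ℓs)
layout-settled [] = []
layout-settled (ℓ ∷ ℓs) = ++⁺ (All.map Settled-suc (layout-settled ℓs)) (block-settled ℓ)

Settled-∉-block : ∀ {p ℓ} → Settled n p → p ∉ block n ℓ
Settled-∉-block {n} {ℓ = ℓ} settled p∈ with ∈-++⁻ (applyUpTo (suc n ,_) ℓ) p∈
... | inj₂ (here refl) with marker n<n ← settled = <-irrefl refl n<n
... | inj₁ p∈entries with _ , _ , refl ← ∈-applyUpTo⁻ (suc n ,_) p∈entries
  with entry n<n ← settled = <-irrefl refl n<n

block-unique : ∀ ℓ → Unique (block k ℓ)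
block-unique ℓ = Unique.++⁺
  (Unique.applyUpTo⁺₁ _ ℓ (λ i<j _ → <⇒≢ i<j ∘ cong proj₂))
  ([] ∷ [])
  (λ { (p∈ , here refl) → 0≢1+n (cong proj₁ (proj₂ (proj₂ (∈-applyUpTo⁻ _ p∈)))) })

layout-unique : (ℓs : Vec ℕ n) → Unique (layout ℓs)
layout-unique [] = []
layout-unique (ℓ ∷ ℓs) = Unique.++⁺ (layout-unique ℓs) (block-unique ℓ)
  (λ (p∈ , p∈block) → Settled-∉-block (All.lookup (layout-settled ℓs) p∈) p∈block)

length-block : ∀ ℓ → length (block k ℓ) ≡ suc ℓ
length-block ℓ = trans (length-++ (applyUpTo _ ℓ)) (trans (cong (_+ 1) (length-applyUpTo _ ℓ)) (+-comm ℓ 1))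

n≤length-layout : (ℓs : Vec ℕ n) → n ≤ length (layout ℓs)
n≤length-layout [] = z≤n
n≤length-layout {suc n} (ℓ ∷ ℓs) = begin
  suc n                                        ≤⟨ s≤s (n≤length-layout ℓs) ⟩
  suc (length (layout ℓs))                     ≤⟨ m<m+n _ (s≤s z≤n) ⟩
  length (layout ℓs) + suc ℓ                   ≡⟨ cong (length (layout ℓs) +_) (length-block ℓ) ⟨
  length (layout ℓs) + length (block n ℓ)      ≡⟨ length-++ (layout ℓs) ⟨
  length (layout ℓs ++ block n ℓ)              ∎
  where open ≤-Reasoning

stage : Vec ℕ n → ℕ → U
stage {n} ℓs j = encode ((layout ℓs ++ˢ (suc n ,_)) j)

stage-tail : ∀ (ℓs : Vec ℕ n) m → stage ℓs (length (layout ℓs) + m) ≡ encode (suc n , m)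
stage-tail ℓs m = cong encode (++ˢ-length+ (layout ℓs) _ m)

stage-noisy : (ℓs : Vec ℕ n) → NoisyEnumeration (Column (suc n)) (stage ℓs)
stage-noisy {n} ℓs =
    ++ˢ-injective (layout-unique ℓs) (cong proj₂) column-fresh ∘ encode-injective
  , (λ { z (m , refl) → length (layout ℓs) + m , stage-tail ℓs m })
  , length (layout ℓs) , map encode (layout ℓs) , ≤-reflexive (length-map encode (layout ℓs)) , noise
  where
  column-fresh : ∀ m → (suc n , m) ∉ layout ℓs
  column-fresh m p∈ with entry n<n ← All.lookup (layout-settled ℓs) p∈ = <-irrefl refl n<n

  noise : ∀ j → ¬ Column (suc n) (stage ℓs j) → stage ℓs j ∈ map encode (layout ℓs)
  noise j ¬column with ++ˢ-∈⊎ (layout ℓs) (suc n ,_) j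
  ... | inj₁ p∈ = ∈-map⁺ encode p∈
  ... | inj₂ (m , eq) = ⊥-elim (¬column (m , cong encode eq))

-- Diagonalisation against a noisy generator

module Diagonal (G : Generator) (H : NoisilyGenerates Anchored G) where

  run : (ℓs : Vec ℕ n) → EventuallyGenerates G (Column (suc n)) (stage ℓs)
  run {n} ℓs = H (Column (suc n)) (Column-anchored (suc n)) (stage ℓs) (stage-noisy ℓs)

  settlingTime : Vec ℕ n → ℕ
  settlingTime ℓs = proj₁ (run ℓs)

  -- Block k gets one entry more than the settling time of G on stage k, so all
  -- later stages agree with stage k up to the time T k from which on G outputs
  -- fresh elements of column k + 1 when shown stage k.
  lengths : (k : ℕ) → Vec ℕ k
  lengths zero = []
  lengths (suc k) = suc (settlingTime (lengths k)) ∷ lengths k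

  P : ℕ → List (ℕ × ℕ)
  P k = layout (lengths k)

  σ : ℕ → ℕ → U
  σ k = stage (lengths k)

  len : ℕ → ℕ
  len k = suc (settlingTime (lengths k))

  T : ℕ → ℕ
  T k = length (P k) + settlingTime (lengths k)

  k≤T : ∀ k → k ≤ T k
  k≤T k = ≤-trans (n≤length-layout (lengths k)) (m≤m+n _ _)

  <length⇒≤T : ∀ k → j < length (P k) → j ≤ T k
  <length⇒≤T k j< = ≤-trans (<⇒≤ j<) (m≤m+n _ _)

  layout-extends : k < k′ → ∃[ R ] P k′ ≡ P k ++ (applyUpTo (suc k ,_) (len k) ++ R)
  layout-extends {k} {suc k′} (s≤s k≤k′) with m≤n⇒m<n∨m≡n k≤k′
  ... | inj₂ refl = [ 0 , k ] , refl
  ... | inj₁ k<k′ with R , eq ← layout-extends k<k′ = R ++ block k′ (len k′) , (begin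
    P k′ ++ block k′ (len k′)                   ≡⟨ cong (_++ block k′ (len k′)) eq ⟩
    (P k ++ (entries ++ R)) ++ block k′ (len k′) ≡⟨ ++-assoc (P k) _ _ ⟩
    P k ++ ((entries ++ R) ++ block k′ (len k′)) ≡⟨ cong (P k ++_) (++-assoc entries R _) ⟩
    P k ++ (entries ++ (R ++ block k′ (len k′))) ∎)
    where
    open ≡-Reasoning
    entries = applyUpTo (suc k ,_) (len k)

  σ-stable : k ≤ k′ → j ≤ T k → σ k′ j ≡ σ k j
  σ-stable k≤k′ j≤T with m≤n⇒m<n∨m≡n k≤k′
  ... | inj₂ refl = refl
  σ-stable {k} {k′} {j} _ j≤T | inj₁ k<k′ with R , eq ← layout-extends k<k′ = begin
    σ k′ j
      ≡⟨ cong (λ xs → encode ((xs ++ˢ (suc k′ ,_)) j)) eq ⟩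
    encode (((P k ++ (entries ++ R)) ++ˢ (suc k′ ,_)) j)
      ≡⟨ cong encode (++ˢ-assoc (P k) _ _ j) ⟩
    encode ((P k ++ˢ (entries ++ R) ++ˢ (suc k′ ,_)) j)
      ≡⟨ cong encode (++ˢ-agree (P k) (++ˢ-applyUpTo (suc k ,_) R (suc k′ ,_)) j<) ⟩
    σ k j
      ∎
    where
    open ≡-Reasoning
    entries = applyUpTo (suc k ,_) (len k)
    j< : j < length (P k) + len k
    j< = ≤-<-trans j≤T (+-monoʳ-< (length (P k)) ≤-refl)

  -- stages from k on agree up to T k, and j ≤ T j
  limit : ℕ → U
  limit j = σ j j

  limit-agrees : ∀ k → j ≤ T k → limit j ≡ σ k j
  limit-agrees {j} k j≤T with ≤-total j k
  ... | inj₁ j≤k = sym (σ-stable j≤k (k≤T j))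
  ... | inj₂ k≤j = σ-stable k≤j j≤T

  data Chosen : ℕ × ℕ → Set where
    marker : ∀ k → Chosen (0 , k)
    entry : ∀ {m} → m < len k → Chosen (suc k , m)

  Limit : Subset
  Limit z = ∃[ p ] (Chosen p × z ≡ encode p)

  layout-chosen : ∀ k → All Chosen (P k)
  layout-chosen zero = []
  layout-chosen (suc k) = ++⁺ (layout-chosen k) (++⁺ (applyUpTo⁺₁ (suc k ,_) (len k) entry) (marker k ∷ []))

  Chosen⇒∈layout : ∀ {p} → Chosen p → ∃[ k ] p ∈ P k
  Chosen⇒∈layout (marker k) = suc k , ∈-++⁺ʳ (P k) (∈-++⁺ʳ (applyUpTo (suc k ,_) (len k)) (here refl))
  Chosen⇒∈layout (entry {k} m<) = suc k , ∈-++⁺ʳ (P k) (∈-++⁺ˡ (∈-applyUpTo⁺ (suc k ,_) m<))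

  Limit-anchored : Anchored Limit
  Limit-anchored = record
    { anchor = 0
    ; column⊆ = λ m → (0 , m) , marker m , refl
    ; ⊆right = λ _ → z≤n
    }

  limit-noisy : NoisyEnumeration Limit limit
  limit-noisy = injective , covers , 0 , [] , z≤n , λ j ¬limit → ⊥-elim (¬limit (limit-in j))
    where
    injective : Injective _≡_ _≡_ limit
    injective {j} {j′} eq = proj₁ (stage-noisy (lengths (j ⊔ j′))) (begin
      σ (j ⊔ j′) j  ≡⟨ limit-agrees (j ⊔ j′) (≤-trans (m≤m⊔n j j′) (k≤T _)) ⟨
      limit j       ≡⟨ eq ⟩
      limit j′      ≡⟨ limit-agrees (j ⊔ j′) (≤-trans (m≤n⊔m j j′) (k≤T _)) ⟩
      σ (j ⊔ j′) j′ ∎)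
      where open ≡-Reasoning

    covers : ∀ z → Limit z → InRange limit z
    covers _ (p , chosen , refl)
      with k , p∈ ← Chosen⇒∈layout chosen
      with j , j< , eq ← ∈⇒++ˢ (suc k ,_) p∈ =
      j , trans (limit-agrees k (<length⇒≤T k j<)) (cong encode eq)

    limit-in : ∀ j → Limit (limit j)
    limit-in j = _ , All.lookup (layout-chosen (suc j)) (++ˢ-∈ (P (suc j)) (suc (suc j) ,_) j<)
                   , limit-agrees (suc j) (<length⇒≤T (suc j) j<)
      where
      j< : j < length (P (suc j))
      j< = n≤length-layout (lengths (suc j))

  Chosen-column : ∀ {m} → Chosen (suc k , m) → m < len k
  Chosen-column (entry m<) = m<

  stage-output-unchosen : ∀ k → ¬ Limit (out G (σ k) (T k))
  stage-output-unchosen k (p , chosen , o≡p)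
    with (m , o≡) , o-new ← proj₂ (run (lengths k)) (T k) (m≤n+m _ (length (P k)))
    with refl ← encode-injective {p} {suc k , m} (trans (sym o≡p) o≡) =
    o-new (subst (_∈ prefix (σ k) (T k)) (trans (stage-tail (lengths k) m) (sym o≡))
                 (∈-prefix⁺ (σ k) (+-monoʳ-≤ (length (P k)) (≤-pred (Chosen-column chosen)))))

  contradiction : ⊥
  contradiction with k , generates ← H Limit Limit-anchored limit limit-noisy =
    stage-output-unchosen k (subst Limit (cong G (prefix-cong {t = T k} (limit-agrees k)))
                                         (proj₁ (generates (T k) (k≤T k))))

theorem1p5 : ∃[ C ] (IsCollectionOfLanguages C
               × (∀ i → ∃[ G ] GeneratesWithNoise i C G)
               × ¬ (∃[ G ] NoisilyGenerates C G))
theorem1p5 =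
  Anchored , anchored-infinite , (λ i → generator i , generator-correct i) ,
  λ (G , H) → Diagonal.contradiction G H
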